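{- Let $a,b$ be positive integers, let $S_{a,b}$ be the double star and let $m=a+b+1$. (i) If $2\le a\le 6$ and $S_{a,b}+cP_3$ is antimagic for a nonnegative integer $c$, then $c\le 3a+2b+1=2m+a-1$. (ii) If $a=7$, $b\le 21$, and $S_{7,b}+cP_3$ is antimagic for a nonnegative integer $c$, then $c\le 2b+21=2m+5$.
   Context: All graphs are simple. For a graph $G$ with $m$ edges, an antimagic labeling is a bijection $f:E(G)\to\{1,\dots,m\}$ such that the vertex sums $\phi(v)=\sum_{e\ni v} f(e)$ are pairwise distinct; $G$ is antimagic if it has such a labeling. $G+cP_3$ denotes the disjoint union of $G$ with $c$ copies of the path $P_3$ on 3 vertices. The double star $S_{a,b}$ is the tree consisting of an edge $xy$ together with $a$ pendant edges attached at $x$ and $b$ pendant edges attached at $y$; it has $a+b+1$ edges. -}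

module Defs where

open import Data.Nat using (ℕ; zero; suc)
open import Data.Fin using (Fin; toℕ)
open import Data.Fin.Properties renaming (_≟_ to _≟F_)
open import Data.List using (List; allFin; map)
open import Data.Nat.ListAction using (sum)
open import Data.Product using (Σ; _×_; _,_; proj₁; proj₂)
open import Data.Sum using (_⊎_; inj₁; inj₂)
open import Data.Sum.Properties using (≡-dec)
open import Data.Product.Properties using () renaming (≡-dec to ≡-dec×)
open import Relation.Binary.Definitions using (DecidableEquality)
open import Relation.Binary.PropositionalEquality using (_≡_; refl)
open import Relation.Nullary using (yes; no)
open import Function.Bundles using (_↔_; Inverse)
open import Function.Definitions using (Injective)

record Graph : Set₁ where
  field
    V     : Set
    _≟V_  : DecidableEquality V
    E     : Set
    ends  : E → V × V

open Graph public

contrib : (G : Graph) → E G → V G → ℕ → ℕ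
contrib G e v l with _≟V_ G (proj₁ (ends G e)) v | _≟V_ G (proj₂ (ends G e)) v
... | yes _ | _     = l
... | no _  | yes _ = l
... | no _  | no _  = 0

-- vertex sum φ(v) for the labeling given by a bijection f : E ↔ Fin m,
-- edge e gets label toℕ (f e) + 1 ∈ {1,…,m}
vertexSum : (G : Graph) {m : ℕ} → (E G ↔ Fin m) → V G → ℕ
vertexSum G {m} f v =
  sum (map (λ k → contrib G (Inverse.from f k) v (suc (toℕ k))) (allFin m))

-- G is antimagic: there is a bijection from the edges onto {1,…,m}
-- (m is then necessarily the number of edges) with injective vertex sums.
Antimagic : Graph → Set
Antimagic G =
  Σ ℕ λ m → Σ (E G ↔ Fin m) λ f → Injective _≡_ _≡_ (vertexSum G f)

data DSV (a b : ℕ) : Set where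
  cx cy : DSV a b
  lx : Fin a → DSV a b
  ly : Fin b → DSV a b

data DSE (a b : ℕ) : Set where
  exy : DSE a b
  ex  : Fin a → DSE a b
  ey  : Fin b → DSE a b

_≟DSV_ : ∀ {a b} → DecidableEquality (DSV a b)
cx ≟DSV cx = yes refl
cx ≟DSV cy = no λ ()
cx ≟DSV lx _ = no λ ()
cx ≟DSV ly _ = no λ ()
cy ≟DSV cx = no λ ()
cy ≟DSV cy = yes refl
cy ≟DSV lx _ = no λ ()
cy ≟DSV ly _ = no λ ()
lx _ ≟DSV cx = no λ ()
lx _ ≟DSV cy = no λ ()
lx i ≟DSV lx j with i ≟F j
... | yes refl = yes refl
... | no i≢j = no λ { refl → i≢j refl }
lx _ ≟DSV ly _ = no λ ()
ly _ ≟DSV cx = no λ ()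
ly _ ≟DSV cy = no λ ()
ly _ ≟DSV lx _ = no λ ()
ly i ≟DSV ly j with i ≟F j
... | yes refl = yes refl
... | no i≢j = no λ { refl → i≢j refl }

dsEnds : ∀ {a b} → DSE a b → DSV a b × DSV a b
dsEnds exy    = cx , cy
dsEnds (ex i) = cx , lx i
dsEnds (ey j) = cy , ly j

p3Ends : ∀ {c} → Fin c × Fin 2 → (Fin c × Fin 3) × (Fin c × Fin 3)
p3Ends (i , Fin.zero)  = (i , Fin.zero) , (i , Fin.suc Fin.zero)
p3Ends (i , Fin.suc _) = (i , Fin.suc Fin.zero) , (i , Fin.suc (Fin.suc Fin.zero))

DoubleStarPlusP3 : ℕ → ℕ → ℕ → Graph
DoubleStarPlusP3 a b c = record
  { V    = DSV a b ⊎ (Fin c × Fin 3)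
  ; _≟V_ = ≡-dec _≟DSV_ (≡-dec× _≟F_ _≟F_)
  ; E    = DSE a b ⊎ (Fin c × Fin 2)
  ; ends = λ { (inj₁ e) → inj₁ (proj₁ (dsEnds e)) , inj₁ (proj₂ (dsEnds e))
             ; (inj₂ e) → inj₂ (proj₁ (p3Ends e)) , inj₂ (proj₂ (p3Ends e)) }
  }

{-# OPTIONS --safe #-}
module Submission where

-- Every edge other than xy is pendant, and a leaf's vertex sum is the label of its edge, so the
-- leaves take exactly the values {1,…,m} minus ℓ(xy).  Hence the sum at a non-leaf vertex is ℓ(xy)
-- or exceeds m.  The sum at x exceeds ℓ(xy), and by injectivity at most one P₃-centre (say that of
-- copy i₀) has sum ℓ(xy); so x and the remaining c − 1 centres carry c distinct sums above m.  The
-- edges at these vertices, the two edges of copy i₀ and the b pendant edges at y partition E, and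
-- the last b + 2 carry distinct positive labels.  With T the triangular numbers this gives
-- c m + T(c) + T(b + 2) ≤ T(m) for m = a + b + 1 + 2c, a quadratic inequality in c which fails
-- beyond the stated bounds.

open import Defs
open import Data.Nat using (ℕ; _≤_; _+_; _*_)
open import Data.Product using (_×_)
open import Relation.Binary.PropositionalEquality using (_≡_)

open import Data.Empty using (⊥; ⊥-elim)
open import Data.Unit using (⊤; tt)
open import Data.Fin using (Fin; zero; suc; toℕ; fromℕ<; punchIn)
open import Data.Fin.Patterns using (0F; 1F; 2F)
open import Data.Fin.Properties
  using (toℕ-injective; toℕ-fromℕ<; any?; punchIn-injective; punchInᵢ≢i)
  renaming (suc-injective to Fin-suc-injective)
open import Data.List using (List; []; _∷_; _++_; length; map; tabulate; allFin; cartesianProduct)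
open import Data.List.Properties
  using (map-++; map-∘; map-cong; map-tabulate; length-++; length-map; length-tabulate)
open import Data.List.Membership.Propositional using (_∈_)
open import Data.List.Membership.Propositional.Properties
  using (∈-allFin; ∈-map⁺; ∈-map⁻; ∈-tabulate⁺; ∈-tabulate⁻; ∈-++⁺ˡ; ∈-++⁺ʳ; ∈-cartesianProduct⁺)
open import Data.List.Membership.Propositional.Properties.WithK using (unique∧set⇒bag)
open import Data.List.Relation.Binary.BagAndSetEquality using (∼bag⇒↭)
open import Data.List.Relation.Binary.Disjoint.Propositional using (Disjoint)
open import Data.List.Relation.Binary.Permutation.Propositional using (_↭_; ↭-sym; ↭⇒↭ₛ)
import Data.List.Relation.Binary.Permutation.Propositional.Properties as Permutation
import Data.List.Relation.Binary.Permutation.Setoid.Properties as PermutationSetoid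
open import Data.List.Relation.Unary.All using (All; []; _∷_)
import Data.List.Relation.Unary.All.Properties as All
open import Data.List.Relation.Unary.AllPairs as AllPairs using (AllPairs; []; _∷_)
open import Data.List.Relation.Unary.Any using (here; there)
open import Data.List.Relation.Unary.Sorted.TotalOrder.Properties using (Sorted⇒AllPairs)
open import Data.List.Relation.Unary.Unique.Propositional using (Unique)
import Data.List.Relation.Unary.Unique.Propositional.Properties as Unique
open import Data.Nat using (zero; suc; _∸_; _<_; z≤n; s≤s; _≟_)
open import Data.Nat.ListAction using (sum)
open import Data.Nat.ListAction.Properties using (sum-++; sum-↭)
open import Data.Nat.Properties
  using ( ≤-totalOrder; ≤-decTotalOrder; module ≤-Reasoning; ≤-trans; ≤∧≢⇒<; ≰⇒>; ≮⇒≥; <⇒≱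
        ; n≤1+n; m≤m+n; m≤n⇒∃[o]m+o≡n; m+1+n≢m; suc-injective; +-comm; +-identityʳ; *-comm
        ; *-zeroʳ; *-distribˡ-+; *-distribʳ-+; +-mono-≤; +-monoˡ-≤; +-monoʳ-≤; *-monoʳ-≤
        ; +-cancelˡ-≤; *-cancelˡ-<; +-commutativeSemigroup)
open import Algebra.Properties.CommutativeSemigroup +-commutativeSemigroup using (x∙yz≈y∙xz)
open import Data.Nat.Tactic.RingSolver using (solve-∀)
open import Data.List.Sort ≤-decTotalOrder using (sort; sort-↭; sort-↗)
open import Data.Product using (Σ; _,_; proj₁; proj₂)
open import Data.Sum using (inj₁; inj₂)
open import Function using (_∘_; _↔_; Inverse; Injection; mk⇔)
open import Function.Definitions using (Injective)
open import Function.Properties.Inverse using (↔⇒↣)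
open import Relation.Binary.PropositionalEquality
  using (_≢_; refl; sym; trans; cong; cong₂; subst; subst₂; setoid; module ≡-Reasoning)
open import Relation.Nullary using (¬_; yes; no)

triangular : ℕ → ℕ
triangular zero    = 0
triangular (suc n) = suc n + triangular n

double-triangular : ∀ n → 2 * triangular n ≡ n * suc n
double-triangular zero    = refl
double-triangular (suc n) = begin
  2 * (suc n + triangular n)      ≡⟨ *-distribˡ-+ 2 (suc n) (triangular n) ⟩
  2 * suc n + 2 * triangular n    ≡⟨ cong (2 * suc n +_) (double-triangular n) ⟩
  2 * suc n + n * suc n           ≡⟨ *-distribʳ-+ (suc n) 2 n ⟨
  suc (suc n) * suc n             ≡⟨ *-comm (suc (suc n)) (suc n) ⟩
  suc n * suc (suc n)             ∎
  where open ≡-Reasoning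

sum-tabulate-suc : ∀ {n} (g : Fin n → ℕ) → sum (tabulate (suc ∘ g)) ≡ n + sum (tabulate g)
sum-tabulate-suc {zero}  g = refl
sum-tabulate-suc {suc n} g = cong suc (begin
  g zero + sum (tabulate (suc ∘ g ∘ suc))  ≡⟨ cong (g zero +_) (sum-tabulate-suc (g ∘ suc)) ⟩
  g zero + (n + sum (tabulate (g ∘ suc)))  ≡⟨ x∙yz≈y∙xz (g zero) n _ ⟩
  n + (g zero + sum (tabulate (g ∘ suc)))  ∎)
  where open ≡-Reasoning

sum-tabulate-≡0 : ∀ {n} {g : Fin n → ℕ} → (∀ i → g i ≡ 0) → sum (tabulate g) ≡ 0
sum-tabulate-≡0 {zero}  g≡0 = refl
sum-tabulate-≡0 {suc n} g≡0 = cong₂ _+_ (g≡0 zero) (sum-tabulate-≡0 (g≡0 ∘ suc))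

sum-tabulate-single : ∀ {n} {g : Fin n → ℕ} i → (∀ j → j ≢ i → g j ≡ 0) →
                      sum (tabulate g) ≡ g i
sum-tabulate-single {suc n} {g} zero    g≡0 =
  trans (cong (g zero +_) (sum-tabulate-≡0 (λ j → g≡0 (suc j) λ ()))) (+-identityʳ (g zero))
sum-tabulate-single {suc n} {g} (suc i) g≡0 =
  cong₂ _+_ (g≡0 zero λ ())
            (sum-tabulate-single i (λ j j≢i → g≡0 (suc j) (j≢i ∘ Fin-suc-injective)))

sum-tabulate-punchIn : ∀ {n} (g : Fin (suc n) → ℕ) i →
                       sum (tabulate g) ≡ g i + sum (tabulate (g ∘ punchIn i))
sum-tabulate-punchIn         g zero    = refl
sum-tabulate-punchIn {suc n} g (suc i) =
  trans (cong (g zero +_) (sum-tabulate-punchIn (g ∘ suc) i)) (x∙yz≈y∙xz (g zero) (g (suc i)) _)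

sum-allFin-suc : ∀ n → sum (map (suc ∘ toℕ) (allFin n)) ≡ triangular n
sum-allFin-suc n =
  trans (cong sum (map-tabulate {n = n} (λ i → i) (suc ∘ toℕ))) (sum-tabulate-toℕ n)
  where
  sum-tabulate-toℕ : ∀ n → sum (tabulate {n = n} (suc ∘ toℕ)) ≡ triangular n
  sum-tabulate-toℕ zero    = refl
  sum-tabulate-toℕ (suc n) =
    cong suc (trans (sum-tabulate-suc {n} (suc ∘ toℕ)) (cong (n +_) (sum-tabulate-toℕ n)))

sum-increasing-≥ : ∀ {m xs} → AllPairs _<_ xs → All (m <_) xs →
                   length xs * m + triangular (length xs) ≤ sum xs
sum-increasing-≥ {m} {[]}     []           []        = z≤n
sum-increasing-≥ {m} {x ∷ xs} (x<xs ∷ xs↑) (m<x ∷ _) = begin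
  suc n * m + triangular (suc n)      ≡⟨ rearrange n m (triangular n) ⟩
  suc m + (n * suc m + triangular n)
    ≤⟨ +-mono-≤ m<x (+-monoˡ-≤ (triangular n) (*-monoʳ-≤ n m<x)) ⟩
  x + (n * x + triangular n)          ≤⟨ +-monoʳ-≤ x (sum-increasing-≥ xs↑ x<xs) ⟩
  x + sum xs                          ∎
  where
  open ≤-Reasoning
  n : ℕ
  n = length xs
  rearrange : ∀ n m t → suc n * m + (suc n + t) ≡ suc m + (n * suc m + t)
  rearrange = solve-∀

sum-distinct-≥ : ∀ {m xs} → Unique xs → All (m <_) xs →
                 length xs * m + triangular (length xs) ≤ sum xs
sum-distinct-≥ {m} {xs} xs! m<xs =
  subst₂ (λ n s → n * m + triangular n ≤ s) (Permutation.↭-length sorted↭xs) (sum-↭ sorted↭xs)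
    (sum-increasing-≥ sorted↑ (Permutation.All-resp-↭ (↭-sym sorted↭xs) m<xs))
  where
  sorted↭xs : sort xs ↭ xs
  sorted↭xs = sort-↭ xs
  sorted! : Unique (sort xs)
  sorted! = PermutationSetoid.Unique-resp-↭ (setoid ℕ) (↭⇒↭ₛ (↭-sym sorted↭xs)) xs!
  sorted↑ : AllPairs _<_ (sort xs)
  sorted↑ = AllPairs.zipWith (λ (x≤y , x≢y) → ≤∧≢⇒< x≤y x≢y)
                             (Sorted⇒AllPairs ≤-totalOrder (sort-↗ xs) , sorted!)

sum-map-++ : ∀ {A : Set} (h : A → ℕ) xs ys →
             sum (map h (xs ++ ys)) ≡ sum (map h xs) + sum (map h ys)
sum-map-++ h xs ys = trans (cong sum (map-++ h xs ys)) (sum-++ (map h xs) (map h ys))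

sum-map-cartesianProduct : ∀ {A B : Set} (h : A × B → ℕ) xs ys →
  sum (map h (cartesianProduct xs ys)) ≡ sum (map (λ x → sum (map (λ y → h (x , y)) ys)) xs)
sum-map-cartesianProduct h []       ys = refl
sum-map-cartesianProduct h (x ∷ xs) ys = begin
  sum (map h (map (x ,_) ys ++ cartesianProduct xs ys))
    ≡⟨ sum-map-++ h (map (x ,_) ys) _ ⟩
  sum (map h (map (x ,_) ys)) + sum (map h (cartesianProduct xs ys))
    ≡⟨ cong₂ _+_ (cong sum (sym (map-∘ ys))) (sum-map-cartesianProduct h xs ys) ⟩
  sum (map (λ y → h (x , y)) ys) + sum (map (λ x → sum (map (λ y → h (x , y)) ys)) xs)
    ∎
  where open ≡-Reasoning

length-cartesianProduct : ∀ {A B : Set} (xs : List A) (ys : List B) →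
                          length (cartesianProduct xs ys) ≡ length xs * length ys
length-cartesianProduct []       ys = refl
length-cartesianProduct (x ∷ xs) ys = begin
  length (map (x ,_) ys ++ cartesianProduct xs ys)
    ≡⟨ length-++ (map (x ,_) ys) ⟩
  length (map (x ,_) ys) + length (cartesianProduct xs ys)
    ≡⟨ cong₂ _+_ (length-map (x ,_) ys) (length-cartesianProduct xs ys) ⟩
  length ys + length xs * length ys
    ∎
  where open ≡-Reasoning

map-disjoint : ∀ {A B C : Set} {f : A → C} {g : B → C} {xs ys} →
               (∀ x y → f x ≢ g y) → Disjoint (map f xs) (map g ys)
map-disjoint {f = f} {g} f≢g (fx∈ , gy∈) with ∈-map⁻ f fx∈ | ∈-map⁻ g gy∈
... | x , _ , refl | y , _ , fx≡gy = f≢g x y fx≡gy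

tabulate-disjoint : ∀ {C : Set} {m n} {f : Fin m → C} {g : Fin n → C} →
                    (∀ i j → f i ≢ g j) → Disjoint (tabulate f) (tabulate g)
tabulate-disjoint f≢g (fi∈ , gj∈) with ∈-tabulate⁻ fi∈ | ∈-tabulate⁻ gj∈
... | i , refl | j , fi≡gj = f≢g i j fi≡gj

module _ {A : Set} {m : ℕ} (f : A ↔ Fin m) {xs : List A}
         (xs! : Unique xs) (∈xs : ∀ x → x ∈ xs) where
  open Inverse f

  private
    to-xs↭allFin : map to xs ↭ allFin m
    to-xs↭allFin = ∼bag⇒↭ (unique∧set⇒bag to-xs! (Unique.allFin⁺ m)
                                           λ {k} → mk⇔ (λ _ → ∈-allFin k) (λ _ → k∈ k))
      where
      to-xs! : Unique (map to xs)
      to-xs! = Unique.map⁺ (Injection.injective (↔⇒↣ f)) xs!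
      k∈ : ∀ k → k ∈ map to xs
      k∈ k = subst (_∈ map to xs) (strictlyInverseˡ k) (∈-map⁺ to (∈xs (from k)))

  length-enumeration : length xs ≡ m
  length-enumeration = begin
    length xs           ≡⟨ length-map to xs ⟨
    length (map to xs)  ≡⟨ Permutation.↭-length to-xs↭allFin ⟩
    length (allFin m)   ≡⟨ length-tabulate (λ i → i) ⟩
    m                   ∎
    where open ≡-Reasoning

  sum-reindex : (h : A → ℕ) → sum (map (h ∘ from) (allFin m)) ≡ sum (map h xs)
  sum-reindex h = begin
    sum (map (h ∘ from) (allFin m))   ≡⟨ sum-↭ (Permutation.map⁺ (h ∘ from) to-xs↭allFin) ⟨
    sum (map (h ∘ from) (map to xs))  ≡⟨ cong sum (map-∘ xs) ⟨
    sum (map (h ∘ from ∘ to) xs)      ≡⟨ cong sum (map-cong (cong h ∘ strictlyInverseʳ) xs) ⟩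
    sum (map h xs)                    ∎
    where open ≡-Reasoning

module _ (G : Graph) (e : E G) (v : V G) {l : ℕ} where

  contrib-far : proj₁ (ends G e) ≢ v → proj₂ (ends G e) ≢ v → contrib G e v l ≡ 0
  contrib-far u≢v w≢v with _≟V_ G (proj₁ (ends G e)) v | _≟V_ G (proj₂ (ends G e)) v
  ... | yes u≡v | _       = ⊥-elim (u≢v u≡v)
  ... | no _    | yes w≡v = ⊥-elim (w≢v w≡v)
  ... | no _    | no _    = refl

  contrib-end₁ : proj₁ (ends G e) ≡ v → contrib G e v l ≡ l
  contrib-end₁ u≡v with _≟V_ G (proj₁ (ends G e)) v | _≟V_ G (proj₂ (ends G e)) v
  ... | yes _  | _ = refl
  ... | no u≢v | _ = ⊥-elim (u≢v u≡v)

  contrib-end₂ : proj₂ (ends G e) ≡ v → contrib G e v l ≡ l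
  contrib-end₂ w≡v with _≟V_ G (proj₁ (ends G e)) v | _≟V_ G (proj₂ (ends G e)) v
  ... | yes _ | _      = refl
  ... | no _  | yes _  = refl
  ... | no _  | no w≢v = ⊥-elim (w≢v w≡v)

module Labelling (G : Graph) {m : ℕ} (f : E G ↔ Fin m) where
  open Inverse f

  label : E G → ℕ
  label e = suc (toℕ (to e))

  label-injective : ∀ {d e} → label d ≡ label e → d ≡ e
  label-injective = Injection.injective (↔⇒↣ f) ∘ toℕ-injective ∘ suc-injective

  label-surjective : ∀ {w} → 1 ≤ w → w ≤ m → Σ (E G) λ e → label e ≡ w
  label-surjective {suc w} (s≤s z≤n) w<m =
    from k , trans (cong (suc ∘ toℕ) (strictlyInverseˡ k)) (cong suc (toℕ-fromℕ< w<m))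
    where
    k : Fin m
    k = fromℕ< w<m

  module _ {es : List (E G)} (es! : Unique es) (∈es : ∀ e → e ∈ es) where

    sum-labels : sum (map label es) ≡ triangular m
    sum-labels = begin
      sum (map label es)                   ≡⟨ sum-reindex f es! ∈es label ⟨
      sum (map (label ∘ from) (allFin m))
        ≡⟨ cong sum (map-cong (cong (suc ∘ toℕ) ∘ strictlyInverseˡ) (allFin m)) ⟩
      sum (map (suc ∘ toℕ) (allFin m))     ≡⟨ sum-allFin-suc m ⟩
      triangular m                         ∎
      where open ≡-Reasoning

    vertexSum-enumeration : ∀ v → vertexSum G f v ≡ sum (map (λ e → contrib G e v (label e)) es)
    vertexSum-enumeration v = begin
      vertexSum G f v
        ≡⟨ cong sum (map-cong relabel (allFin m)) ⟩
      sum (map ((λ e → contrib G e v (label e)) ∘ from) (allFin m))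
        ≡⟨ sum-reindex f es! ∈es _ ⟩
      sum (map (λ e → contrib G e v (label e)) es)
        ∎
      where
      open ≡-Reasoning
      relabel : ∀ k → contrib G (from k) v (suc (toℕ k)) ≡ contrib G (from k) v (label (from k))
      relabel k = cong (contrib G (from k) v ∘ suc ∘ toℕ) (sym (strictlyInverseˡ k))

edgeCount : ℕ → ℕ → ℕ → ℕ
edgeCount a b c = suc (a + b) + c * 2

module Edges (a b c : ℕ) where

  xEdges yEdges starEdges : List (DSE a b)
  xEdges    = tabulate ex
  yEdges    = tabulate ey
  starEdges = exy ∷ xEdges ++ yEdges

  pathEdges : List (Fin c × Fin 2)
  pathEdges = cartesianProduct (allFin c) (allFin 2)

  edges : List (E (DoubleStarPlusP3 a b c))
  edges = map inj₁ starEdges ++ map inj₂ pathEdges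

  edges-unique : Unique edges
  edges-unique = Unique.++⁺ (Unique.map⁺ inj₁-injective star!) (Unique.map⁺ inj₂-injective path!)
                            (map-disjoint λ _ _ ())
    where
    inj₁-injective : ∀ {x y : DSE a b} → inj₁ x ≡ inj₁ y → x ≡ y
    inj₁-injective refl = refl
    inj₂-injective : ∀ {x y : Fin c × Fin 2} → inj₂ x ≡ inj₂ y → x ≡ y
    inj₂-injective refl = refl
    star! : Unique starEdges
    star! = All.++⁺ (All.tabulate⁺ {n = a} λ _ ()) (All.tabulate⁺ {n = b} λ _ ())
          ∷ Unique.++⁺ (Unique.tabulate⁺ {n = a} λ { refl → refl })
                       (Unique.tabulate⁺ {n = b} λ { refl → refl })
                       (tabulate-disjoint λ _ _ ())
    path! : Unique pathEdges
    path! = Unique.cartesianProduct⁺ (Unique.allFin⁺ c) (Unique.allFin⁺ 2)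

  ∈-edges : ∀ e → e ∈ edges
  ∈-edges (inj₁ e) = ∈-++⁺ˡ (∈-map⁺ inj₁ (∈-starEdges e))
    where
    ∈-starEdges : ∀ e → e ∈ starEdges
    ∈-starEdges exy    = here refl
    ∈-starEdges (ex i) = there (∈-++⁺ˡ (∈-tabulate⁺ i))
    ∈-starEdges (ey j) = there (∈-++⁺ʳ xEdges (∈-tabulate⁺ j))
  ∈-edges (inj₂ (i , k)) =
    ∈-++⁺ʳ (map inj₁ starEdges) (∈-map⁺ inj₂ (∈-cartesianProduct⁺ (∈-allFin i) (∈-allFin k)))

  length-edges : length edges ≡ edgeCount a b c
  length-edges = begin
    length edges
      ≡⟨ length-++ (map inj₁ starEdges) ⟩
    length (map inj₁ starEdges) + length (map inj₂ pathEdges)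
      ≡⟨ cong₂ _+_ (length-map inj₁ starEdges) (length-map inj₂ pathEdges) ⟩
    suc (length (xEdges ++ yEdges)) + length pathEdges
      ≡⟨ cong₂ (λ s p → suc s + p) star-length path-length ⟩
    edgeCount a b c
      ∎
    where
    open ≡-Reasoning
    star-length : length (xEdges ++ yEdges) ≡ a + b
    star-length = trans (length-++ xEdges)
                        (cong₂ _+_ (length-tabulate {n = a} ex) (length-tabulate {n = b} ey))
    path-length : length pathEdges ≡ c * 2
    path-length = trans (length-cartesianProduct (allFin c) (allFin 2))
                        (cong (_* 2) (length-tabulate {n = c} (λ i → i)))

  sum-edges : (h : E (DoubleStarPlusP3 a b c) → ℕ) → sum (map h edges) ≡
              h (inj₁ exy) + (sum (tabulate (h ∘ inj₁ ∘ ex)) + sum (tabulate (h ∘ inj₁ ∘ ey)))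
              + sum (tabulate (λ i → sum (tabulate (λ k → h (inj₂ (i , k))))))
  sum-edges h = begin
    sum (map h edges)
      ≡⟨ sum-map-++ h (map inj₁ starEdges) (map inj₂ pathEdges) ⟩
    sum (map h (map inj₁ starEdges)) + sum (map h (map inj₂ pathEdges))
      ≡⟨ cong₂ _+_ (cong sum (map-∘ starEdges)) (cong sum (map-∘ pathEdges)) ⟨
    h (inj₁ exy) + sum (map (h ∘ inj₁) (xEdges ++ yEdges)) + sum (map (h ∘ inj₂) pathEdges)
      ≡⟨ cong₂ _+_ (cong (h (inj₁ exy) +_) star-sum) path-sum ⟩
    h (inj₁ exy) + (sum (tabulate (h ∘ inj₁ ∘ ex)) + sum (tabulate (h ∘ inj₁ ∘ ey)))
    + sum (tabulate (λ i → sum (tabulate (λ k → h (inj₂ (i , k))))))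
      ∎
    where
    open ≡-Reasoning
    star-sum : sum (map (h ∘ inj₁) (xEdges ++ yEdges)) ≡
               sum (tabulate (h ∘ inj₁ ∘ ex)) + sum (tabulate (h ∘ inj₁ ∘ ey))
    star-sum = trans (sum-map-++ (h ∘ inj₁) xEdges yEdges)
                     (cong₂ _+_ (cong sum (map-tabulate ex (h ∘ inj₁)))
                                (cong sum (map-tabulate ey (h ∘ inj₁))))
    path-sum : sum (map (h ∘ inj₂) pathEdges) ≡
               sum (tabulate (λ i → sum (tabulate (λ k → h (inj₂ (i , k))))))
    path-sum = trans (sum-map-cartesianProduct (h ∘ inj₂) (allFin c) (allFin 2))
                     (cong sum (map-tabulate {n = c} (λ i → i) _))

module VertexSums {a b c m : ℕ} (f : E (DoubleStarPlusP3 a b c) ↔ Fin m) where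
  open Edges a b c
  open Labelling (DoubleStarPlusP3 a b c) f public

  G : Graph
  G = DoubleStarPlusP3 a b c

  φ : V G → ℕ
  φ = vertexSum G f

  pathSum : Fin c → ℕ
  pathSum i = sum (tabulate (λ k → label (inj₂ (i , k))))

  sum-labels-split : triangular m ≡
    label (inj₁ exy) + (sum (tabulate (label ∘ inj₁ ∘ ex)) + sum (tabulate (label ∘ inj₁ ∘ ey)))
    + sum (tabulate pathSum)
  sum-labels-split = trans (sym (sum-labels edges-unique ∈-edges)) (sum-edges label)

  private
    incident : V G → E G → ℕ
    incident v e = contrib G e v (label e)

    no-edges : ∀ n → sum (tabulate {n = n} (λ _ → 0)) ≡ 0
    no-edges n = sum-tabulate-≡0 {n} (λ _ → refl)

    fromStar : V G → ℕ
    fromStar v = incident v (inj₁ exy)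
               + (sum (tabulate (incident v ∘ inj₁ ∘ ex)) + sum (tabulate (incident v ∘ inj₁ ∘ ey)))

    fromCopy : V G → Fin c → ℕ
    fromCopy v j = sum (tabulate (λ k → incident v (inj₂ (j , k))))

    vertexSum-star : ∀ u → φ (inj₁ u) ≡ fromStar (inj₁ u)
    vertexSum-star u = begin
      φ v                                            ≡⟨ vertexSum-enumeration edges-unique ∈-edges v ⟩
      sum (map (incident v) edges)                   ≡⟨ sum-edges (incident v) ⟩
      fromStar v + sum (tabulate {n = c} (λ _ → 0))  ≡⟨ cong (fromStar v +_) (no-edges c) ⟩
      fromStar v + 0                                 ≡⟨ +-identityʳ (fromStar v) ⟩
      fromStar v                                     ∎
      where
      open ≡-Reasoning
      v : V G
      v = inj₁ u

    vertexSum-path : ∀ i k → φ (inj₂ (i , k)) ≡ fromCopy (inj₂ (i , k)) i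
    vertexSum-path i k = begin
      φ v                             ≡⟨ vertexSum-enumeration edges-unique ∈-edges v ⟩
      sum (map (incident v) edges)    ≡⟨ sum-edges (incident v) ⟩
      sum (tabulate {n = a} (λ _ → 0)) + sum (tabulate {n = b} (λ _ → 0)) + sum (tabulate (fromCopy v))
        ≡⟨ cong₂ (λ x y → x + y + sum (tabulate (fromCopy v))) (no-edges a) (no-edges b) ⟩
      sum (tabulate (fromCopy v))     ≡⟨ sum-tabulate-single i other-copy ⟩
      fromCopy v i                    ∎
      where
      open ≡-Reasoning
      v : V G
      v = inj₂ (i , k)
      other-copy : ∀ j → j ≢ i → fromCopy v j ≡ 0
      other-copy j j≢i = cong₂ _+_ (contrib-far G (inj₂ (j , 0F)) v elsewhere elsewhere)
                                   (cong₂ _+_ (contrib-far G (inj₂ (j , 1F)) v elsewhere elsewhere) refl)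
        where
        elsewhere : ∀ {l} → inj₂ (j , l) ≢ v
        elsewhere refl = j≢i refl

  vertexSum-cx : φ (inj₁ cx) ≡ label (inj₁ exy) + sum (tabulate (label ∘ inj₁ ∘ ex))
  vertexSum-cx = begin
    φ (inj₁ cx)                                      ≡⟨ vertexSum-star cx ⟩
    eℓ + (Σx + sum (tabulate {n = b} (λ _ → 0)))     ≡⟨ cong (λ y → eℓ + (Σx + y)) (no-edges b) ⟩
    eℓ + (Σx + 0)                                    ≡⟨ cong (eℓ +_) (+-identityʳ Σx) ⟩
    eℓ + Σx                                          ∎
    where
    open ≡-Reasoning
    eℓ Σx : ℕ
    eℓ = label (inj₁ exy)
    Σx = sum (tabulate (label ∘ inj₁ ∘ ex))

  vertexSum-lx : ∀ i → φ (inj₁ (lx i)) ≡ label (inj₁ (ex i))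
  vertexSum-lx i = begin
    φ (inj₁ (lx i))                                  ≡⟨ vertexSum-star (lx i) ⟩
    sum (tabulate (incident v ∘ inj₁ ∘ ex)) + sum (tabulate {n = b} (λ _ → 0))
      ≡⟨ cong₂ _+_ (sum-tabulate-single i other) (no-edges b) ⟩
    incident v (inj₁ (ex i)) + 0                     ≡⟨ +-identityʳ _ ⟩
    incident v (inj₁ (ex i))                         ≡⟨ contrib-end₂ G (inj₁ (ex i)) v refl ⟩
    label (inj₁ (ex i))                              ∎
    where
    open ≡-Reasoning
    v : V G
    v = inj₁ (lx i)
    other : ∀ j → j ≢ i → incident v (inj₁ (ex j)) ≡ 0
    other j j≢i = contrib-far G (inj₁ (ex j)) v (λ ()) (λ { refl → j≢i refl })

  vertexSum-ly : ∀ j → φ (inj₁ (ly j)) ≡ label (inj₁ (ey j))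
  vertexSum-ly j = begin
    φ (inj₁ (ly j))                                  ≡⟨ vertexSum-star (ly j) ⟩
    sum (tabulate {n = a} (λ _ → 0)) + sum (tabulate (incident v ∘ inj₁ ∘ ey))
      ≡⟨ cong₂ _+_ (no-edges a) (sum-tabulate-single j other) ⟩
    incident v (inj₁ (ey j))                         ≡⟨ contrib-end₂ G (inj₁ (ey j)) v refl ⟩
    label (inj₁ (ey j))                              ∎
    where
    open ≡-Reasoning
    v : V G
    v = inj₁ (ly j)
    other : ∀ k → k ≢ j → incident v (inj₁ (ey k)) ≡ 0
    other k k≢j = contrib-far G (inj₁ (ey k)) v (λ ()) (λ { refl → k≢j refl })

  vertexSum-path₀ : ∀ i → φ (inj₂ (i , 0F)) ≡ label (inj₂ (i , 0F))
  vertexSum-path₀ i = trans (vertexSum-path i 0F) (trans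
    (cong₂ _+_ (contrib-end₁ G (inj₂ (i , 0F)) (inj₂ (i , 0F)) refl)
               (cong (_+ 0) (contrib-far G (inj₂ (i , 1F)) (inj₂ (i , 0F)) (λ ()) (λ ()))))
    (+-identityʳ _))

  vertexSum-path₁ : ∀ i → φ (inj₂ (i , 1F)) ≡ pathSum i
  vertexSum-path₁ i = trans (vertexSum-path i 1F)
    (cong₂ _+_ (contrib-end₂ G (inj₂ (i , 0F)) (inj₂ (i , 1F)) refl)
               (cong (_+ 0) (contrib-end₁ G (inj₂ (i , 1F)) (inj₂ (i , 1F)) refl)))

  vertexSum-path₂ : ∀ i → φ (inj₂ (i , 2F)) ≡ label (inj₂ (i , 1F))
  vertexSum-path₂ i = trans (vertexSum-path i 2F) (trans
    (cong₂ _+_ (contrib-far G (inj₂ (i , 0F)) (inj₂ (i , 2F)) (λ ()) (λ ()))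
               (cong (_+ 0) (contrib-end₂ G (inj₂ (i , 1F)) (inj₂ (i , 2F)) refl)))
    (+-identityʳ _))

Internal : ∀ {a b c} → V (DoubleStarPlusP3 a b c) → Set
Internal (inj₁ cx)       = ⊤
Internal (inj₁ cy)       = ⊤
Internal (inj₂ (_ , 1F)) = ⊤
Internal _               = ⊥

module Counting {a b c m : ℕ} (f : E (DoubleStarPlusP3 (suc a) b (suc c)) ↔ Fin m)
                (φ-injective : Injective _≡_ _≡_ (vertexSum (DoubleStarPlusP3 (suc a) b (suc c)) f)) where
  open VertexSums f

  private
    eℓ : ℕ
    eℓ = label (inj₁ exy)

    internal-resp-φ : ∀ w {v} → φ w ≡ φ v → Internal v → Internal w
    internal-resp-φ w φw≡φv = subst Internal (sym (φ-injective φw≡φv))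

  label≡internal⇒exy : ∀ {v} e → Internal v → label e ≡ φ v → e ≡ inj₁ exy
  label≡internal⇒exy (inj₁ exy)      _  _   = refl
  label≡internal⇒exy (inj₁ (ex i))   iv ℓ≡φ =
    ⊥-elim (internal-resp-φ (inj₁ (lx i)) (trans (vertexSum-lx i) ℓ≡φ) iv)
  label≡internal⇒exy (inj₁ (ey j))   iv ℓ≡φ =
    ⊥-elim (internal-resp-φ (inj₁ (ly j)) (trans (vertexSum-ly j) ℓ≡φ) iv)
  label≡internal⇒exy (inj₂ (i , 0F)) iv ℓ≡φ =
    ⊥-elim (internal-resp-φ (inj₂ (i , 0F)) (trans (vertexSum-path₀ i) ℓ≡φ) iv)
  label≡internal⇒exy (inj₂ (i , 1F)) iv ℓ≡φ =
    ⊥-elim (internal-resp-φ (inj₂ (i , 2F)) (trans (vertexSum-path₂ i) ℓ≡φ) iv)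

  internal⇒m<φ : ∀ {v} → Internal v → 1 ≤ φ v → φ v ≢ eℓ → m < φ v
  internal⇒m<φ iv 1≤φv φv≢eℓ = ≰⇒> λ φv≤m →
    let e , ℓe≡φv = label-surjective 1≤φv φv≤m
    in φv≢eℓ (trans (sym ℓe≡φv) (cong label (label≡internal⇒exy e iv ℓe≡φv)))

  -- x has a leaf, so its sum is ℓ(xy) plus a positive amount.
  m<φ-cx : m < φ (inj₁ cx)
  m<φ-cx = internal⇒m<φ tt (subst (1 ≤_) (sym vertexSum-cx) (s≤s z≤n))
                            (m+1+n≢m eℓ ∘ trans (sym vertexSum-cx))

  m<pathSum : ∀ {i} → pathSum i ≢ eℓ → m < pathSum i
  m<pathSum {i} sᵢ≢eℓ = subst (m <_) (vertexSum-path₁ i)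
    (internal⇒m<φ tt (subst (1 ≤_) (sym (vertexSum-path₁ i)) (s≤s z≤n))
                     (sᵢ≢eℓ ∘ trans (sym (vertexSum-path₁ i))))

  pathSum-injective : ∀ {i j} → pathSum i ≡ pathSum j → i ≡ j
  pathSum-injective {i} {j} sᵢ≡sⱼ
    with φ-injective (trans (vertexSum-path₁ i) (trans sᵢ≡sⱼ (sym (vertexSum-path₁ j))))
  ... | refl = refl

  exceptional : Σ (Fin (suc c)) λ i₀ → ∀ i → i ≢ i₀ → pathSum i ≢ eℓ
  exceptional with any? (λ i → pathSum i ≟ eℓ)
  ... | yes (i₀ , s₀≡eℓ) = i₀ , λ i i≢i₀ sᵢ≡eℓ →
                             i≢i₀ (pathSum-injective (trans sᵢ≡eℓ (sym s₀≡eℓ)))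
  ... | no ∄i            = zero , λ i _ sᵢ≡eℓ → ∄i (i , sᵢ≡eℓ)

  i₀ : Fin (suc c)
  i₀ = proj₁ exceptional

  large small : List ℕ
  large = φ (inj₁ cx) ∷ tabulate (pathSum ∘ punchIn i₀)
  small = label (inj₂ (i₀ , 0F)) ∷ label (inj₂ (i₀ , 1F)) ∷ tabulate (label ∘ inj₁ ∘ ey)

  large-bound : suc c * m + triangular (suc c) ≤ sum large
  large-bound = begin
    suc c * m + triangular (suc c)
      ≡⟨ cong (λ n → n * m + triangular n) length-large ⟨
    length large * m + triangular (length large)
      ≤⟨ sum-distinct-≥ large! (m<φ-cx ∷ All.tabulate⁺ m<others) ⟩
    sum large
      ∎
    where
    open ≤-Reasoning
    length-large : length large ≡ suc c
    length-large = cong suc (length-tabulate (pathSum ∘ punchIn i₀))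
    m<others : ∀ j → m < pathSum (punchIn i₀ j)
    m<others j = m<pathSum (proj₂ exceptional _ (punchInᵢ≢i i₀ j))
    cx≢path : ∀ i → φ (inj₁ cx) ≢ pathSum i
    cx≢path i φ≡s with φ-injective (trans φ≡s (sym (vertexSum-path₁ i)))
    ... | ()
    large! : Unique large
    large! = All.tabulate⁺ (cx≢path ∘ punchIn i₀)
           ∷ Unique.tabulate⁺ (punchIn-injective i₀ _ _ ∘ pathSum-injective)

  small-bound : triangular (2 + b) ≤ sum small
  small-bound = begin
    triangular (2 + b)
      ≡⟨ cong (_+ triangular (2 + b)) (*-zeroʳ (2 + b)) ⟨
    (2 + b) * 0 + triangular (2 + b)
      ≡⟨ cong (λ n → n * 0 + triangular n) length-small ⟨
    length small * 0 + triangular (length small)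
      ≤⟨ sum-distinct-≥ small! (s≤s z≤n ∷ s≤s z≤n ∷ All.tabulate⁺ (λ _ → s≤s z≤n)) ⟩
    sum small
      ∎
    where
    open ≤-Reasoning
    length-small : length small ≡ 2 + b
    length-small = cong (2 +_) (length-tabulate (label ∘ inj₁ ∘ ey))
    label-distinct : ∀ {d e} → d ≢ e → label d ≢ label e
    label-distinct d≢e = d≢e ∘ label-injective
    small! : Unique small
    small! = (label-distinct (λ ()) ∷ All.tabulate⁺ (λ _ → label-distinct (λ ())))
           ∷ All.tabulate⁺ (λ _ → label-distinct (λ ()))
           ∷ Unique.tabulate⁺ ((λ { refl → refl }) ∘ label-injective)

  sum-large+small : sum large + sum small ≡ triangular m
  sum-large+small = begin
    sum large + sum small
      ≡⟨ cong (λ x → x + R + (ℓ₀ + (ℓ₁ + Σy))) vertexSum-cx ⟩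
    eℓ + Σx + R + (ℓ₀ + (ℓ₁ + Σy))
      ≡⟨ regroup eℓ Σx Σy R ℓ₀ ℓ₁ ⟩
    eℓ + (Σx + Σy) + (pathSum i₀ + R)
      ≡⟨ cong (eℓ + (Σx + Σy) +_) (sum-tabulate-punchIn pathSum i₀) ⟨
    eℓ + (Σx + Σy) + sum (tabulate pathSum)
      ≡⟨ sum-labels-split ⟨
    triangular m
      ∎
    where
    open ≡-Reasoning
    Σx Σy R ℓ₀ ℓ₁ : ℕ
    Σx = sum (tabulate (label ∘ inj₁ ∘ ex))
    Σy = sum (tabulate (label ∘ inj₁ ∘ ey))
    R  = sum (tabulate (pathSum ∘ punchIn i₀))
    ℓ₀ = label (inj₂ (i₀ , 0F))
    ℓ₁ = label (inj₂ (i₀ , 1F))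
    regroup : ∀ e x y r p q → e + x + r + (p + (q + y)) ≡ e + (x + y) + (p + (q + 0) + r)
    regroup = solve-∀

  bound : suc c * m + triangular (suc c) + triangular (2 + b) ≤ triangular m
  bound = subst (suc c * m + triangular (suc c) + triangular (2 + b) ≤_) sum-large+small
                (+-mono-≤ large-bound small-bound)

CountingBound : ℕ → ℕ → ℕ → Set
CountingBound a b c =
  c * edgeCount a b c + triangular c + triangular (2 + b) ≤ triangular (edgeCount a b c)

triangular-violated : ∀ n c d → n * suc n < 2 * (c * n) + c * suc c + d * suc d →
                      triangular n < c * n + triangular c + triangular d
triangular-violated n c d doubled =
  *-cancelˡ-< 2 _ _ (subst₂ _<_ (sym (double-triangular n)) (sym doubled-sum) doubled)
  where
  open ≡-Reasoning
  doubled-sum : 2 * (c * n + triangular c + triangular d) ≡ 2 * (c * n) + c * suc c + d * suc d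
  doubled-sum = begin
    2 * (c * n + triangular c + triangular d)
      ≡⟨ *-distribˡ-+ 2 (c * n + triangular c) (triangular d) ⟩
    2 * (c * n + triangular c) + 2 * triangular d
      ≡⟨ cong (_+ 2 * triangular d) (*-distribˡ-+ 2 (c * n) (triangular c)) ⟩
    2 * (c * n) + 2 * triangular c + 2 * triangular d
      ≡⟨ cong₂ (λ x y → 2 * (c * n) + x + y) (double-triangular c) (double-triangular d) ⟩
    2 * (c * n) + c * suc c + d * suc d
      ∎

bound-violated-i : ∀ {a b c} → 2 ≤ a → 3 * a + 2 * b + 1 < c → ¬ CountingBound a b c
bound-violated-i {suc (suc p)} {b} (s≤s (s≤s z≤n)) c-large with m≤n⇒∃[o]m+o≡n c-large
... | t , refl = <⇒≱ (triangular-violated n c (2 + b)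
                       (subst (n * suc n <_) (sym (expand p b t)) (s≤s (m≤m+n (n * suc n) _))))
  where
  c n : ℕ
  c = suc (3 * (2 + p) + 2 * b + 1) + t
  n = edgeCount (2 + p) b c
  expand : ∀ p b t →
    let a = 2 + p ; c = suc (3 * a + 2 * b + 1) + t ; n = suc (a + b) + c * 2 in
    2 * (c * n) + c * suc c + (2 + b) * suc (2 + b) ≡
    suc (n * suc n + (p + t + p * suc p + 2 * (a + b + 1) * t + (suc p + t) * (suc p + t)))
  expand = solve-∀

bound-violated-ii : ∀ {a b c} → suc (a + b) < (a ∸ 1) * (a ∸ 2) → 3 * a + 2 * b < c →
                    ¬ CountingBound a b c
bound-violated-ii {suc (suc (suc p))} {b} k-small c-large with m≤n⇒∃[o]m+o≡n c-large
... | t , refl =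
  <⇒≱ (triangular-violated n c (2 + b) (≤-trans (n≤1+n _) (+-cancelˡ-≤ (2 * k) _ _ shifted)))
  where
  open ≤-Reasoning
  k c n : ℕ
  k = suc (3 + p + b)
  c = suc (3 * (3 + p) + 2 * b) + t
  n = edgeCount (3 + p) b c
  regroup : ∀ k y → 2 * k + (2 + y) ≡ 2 * suc k + y
  regroup = solve-∀
  expand : ∀ p b t →
    let a = 3 + p ; k = suc (a + b) ; c = suc (3 * a + 2 * b) + t ; n = suc (a + b) + c * 2 in
    2 * k + (2 * (c * n) + c * suc c + (2 + b) * suc (2 + b)) ≡
    2 * ((2 + p) * (1 + p)) + n * suc n + t * (2 * k + 2 * p + 3 + t)
  expand = solve-∀
  shifted : 2 * k + (2 + n * suc n) ≤ 2 * k + (2 * (c * n) + c * suc c + (2 + b) * suc (2 + b))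
  shifted = begin
    2 * k + (2 + n * suc n)                    ≡⟨ regroup k (n * suc n) ⟩
    2 * suc k + n * suc n                      ≤⟨ +-monoˡ-≤ (n * suc n) (*-monoʳ-≤ 2 k-small) ⟩
    2 * ((2 + p) * (1 + p)) + n * suc n        ≤⟨ m≤m+n _ _ ⟩
    2 * ((2 + p) * (1 + p)) + n * suc n + _    ≡⟨ expand p b t ⟨
    2 * k + (2 * (c * n) + c * suc c + (2 + b) * suc (2 + b)) ∎

antimagic-bound : ∀ {a b c} → 1 ≤ a → 1 ≤ c → Antimagic (DoubleStarPlusP3 a b c) →
                  CountingBound a b c
antimagic-bound {suc a} {b} {suc c} (s≤s z≤n) (s≤s z≤n) (m , f , φ-injective) =
  subst (λ n → suc c * n + triangular (suc c) + triangular (2 + b) ≤ triangular n) m≡edgeCount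
    (Counting.bound f φ-injective)
  where
  open Edges (suc a) b (suc c)
  m≡edgeCount : m ≡ edgeCount (suc a) b (suc c)
  m≡edgeCount = trans (sym (length-enumeration f edges-unique ∈-edges)) length-edges

lemma2 : (a b c : ℕ) → 1 ≤ a → 1 ≤ b →
         Antimagic (DoubleStarPlusP3 a b c) →
         ((2 ≤ a → a ≤ 6 → c ≤ 3 * a + 2 * b + 1) ×
          (a ≡ 7 → b ≤ 21 → c ≤ 2 * b + 21))
lemma2 a b c 1≤a _ antimagic = part-i , part-ii
  where
  bound : 1 ≤ c → CountingBound a b c
  bound 1≤c = antimagic-bound 1≤a 1≤c antimagic

  part-i : 2 ≤ a → a ≤ 6 → c ≤ 3 * a + 2 * b + 1
  part-i 2≤a _ = ≮⇒≥ λ c-large →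
    bound-violated-i 2≤a c-large (bound (≤-trans (s≤s z≤n) c-large))

  part-ii : a ≡ 7 → b ≤ 21 → c ≤ 2 * b + 21
  part-ii refl b≤21 = ≮⇒≥ λ c-large →
    bound-violated-ii (s≤s (s≤s (+-monoʳ-≤ 7 b≤21))) (subst (_< c) (+-comm (2 * b) 21) c-large)
                      (bound (≤-trans (s≤s z≤n) c-large))
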